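{- Let $q$ be a power of two, let $A$ be a $q$-modular witness in a graph $G$, and let $U\subseteq A$ with $|U|=m\ge2$. For $B\subseteq U$ let $n_B$ be the number of vertices $x\in A\setminus U$ with $N(x)\cap U=B$. Let $H_2$ be the graph on vertex set $U$ in which $xy$ is an edge iff $n_{\{x,y\}}\ge q$. Suppose $H_2$ is connected, and, if $m$ is even, suppose in addition there is a subset $C\subseteq U$ of odd cardinality with $n_C\ge q$. Then the classes $[\mathbf 1_B]$ with $n_B\ge q$ span $\mathbb F_2^U/\langle\mathbf 1_U\rangle$. Consequently there is a set $E\subseteq A\setminus U$ with $|E|\le q(m-1)$, a union of pairwise disjoint $q$-element sets of vertices each having a common trace on $U$, such that with $W=A\setminus E$ all degrees $\deg_W(u)$, $u\in U$, are congruent modulo $2q$. If, after this deletion, every vertex of $W\setminus U$ has the same degree residue modulo $2q$ in $G[W]$ as the vertices of $U$, then $W$ is $2q$-modular.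
   Context: Graphs are finite simple; $\deg_S(v)$ is the degree of $v$ in $G[S]$; $S$ is $q$-modular if all $\deg_S(v)$, $v\in S$, are congruent modulo $q$. The trace of $x$ on $U$ is $N(x)\cap U$. $\mathbf 1_B\in\mathbb F_2^U$ is the indicator vector of $B$; the quotient is by the all-ones vector $\mathbf 1_U$. -}

module Defs where

open import Data.Nat using (ℕ; _+_; _*_; _≤_; _∸_)
open import Data.Bool using (Bool; true; false; _xor_; _∧_)
open import Data.Fin using (Fin)
open import Data.Fin.Subset using (Subset; _∈_; _∉_; _⊆_; _∩_; _∪_; _─_; ∣_∣; ⁅_⁆; ⊥)
open import Data.Fin.Subset.Properties using (_∈?_)
open import Data.Vec using (Vec; tabulate; zipWith)
open import Data.Vec.Properties using (≡-dec)
open import Data.List using (List; foldr)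
open import Data.List.Relation.Unary.All using (All)
open import Data.List.Relation.Unary.AllPairs using (AllPairs)
open import Data.Product using (∃₂; _×_)
open import Relation.Binary.PropositionalEquality using (_≡_; _≢_)
open import Relation.Nullary.Decidable using (⌊_⌋)
open import Relation.Binary.Construct.Closure.ReflexiveTransitive using (Star)
import Data.Bool.Properties as BoolP

record Graph (n : ℕ) : Set where
  field
    adj   : Fin n → Fin n → Bool
    sym   : ∀ x y → adj x y ≡ adj y x
    irrefl : ∀ x → adj x x ≡ false

open Graph public

N : ∀ {n} → Graph n → Fin n → Subset n
N G v = tabulate (adj G v)

deg : ∀ {n} → Graph n → Subset n → Fin n → ℕ
deg G S v = ∣ S ∩ N G v ∣

_≡_〔mod_〕 : ℕ → ℕ → ℕ → Set
a ≡ b 〔mod d 〕 = ∃₂ λ s t → a + s * d ≡ b + t * d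

Modular : ∀ {n} → Graph n → ℕ → Subset n → Set
Modular G q S = ∀ u v → u ∈ S → v ∈ S → deg G S u ≡ deg G S v 〔mod q 〕

trace : ∀ {n} → Graph n → Subset n → Fin n → Subset n
trace G U x = N G x ∩ U

count : ∀ {n} → Graph n → Subset n → Subset n → Subset n → ℕ
count G A U B =
  ∣ tabulate (λ x → ⌊ x ∈? (A ─ U) ⌋ ∧ ⌊ ≡-dec BoolP._≟_ (trace G U x) B ⌋) ∣

H₂Edge : ∀ {n} → Graph n → ℕ → Subset n → Subset n → Fin n → Fin n → Set
H₂Edge G q A U x y = x ∈ U × y ∈ U × x ≢ y × q ≤ count G A U (⁅ x ⁆ ∪ ⁅ y ⁆)

H₂Connected : ∀ {n} → Graph n → ℕ → Subset n → Subset n → Set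
H₂Connected G q A U = ∀ x y → x ∈ U → y ∈ U → Star (H₂Edge G q A U) x y

-- Vectors of 𝔽₂^U are represented by subsets of U (indicator vectors);
-- addition is symmetric difference (pointwise xor).
_⊕_ : ∀ {n} → Subset n → Subset n → Subset n
_⊕_ = zipWith _xor_

sum⊕ : ∀ {n} → List (Subset n) → Subset n
sum⊕ = foldr _⊕_ ⊥

⋃ : ∀ {n} → List (Subset n) → Subset n
⋃ = foldr _∪_ ⊥

Disjoint : ∀ {n} → Subset n → Subset n → Set
Disjoint P Q = ∀ x → x ∈ P → x ∉ Q

module Submission where

-- Since A is q-modular, deg_A u = r + a_u q for u ∈ U with a common residue r. Connectivity of
-- H₂ writes every 1_{x} + 1_{y} (x, y ∈ U) as a sum of classes 1_B with n_B ≥ q, hence every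
-- even subset of U; an odd one becomes even after adding 1_U when |U| is odd, or the odd good
-- set C otherwise. Apply this to S = {u ∈ U : a_u ≢ a_{u₀} (mod 2)}: Gaussian elimination
-- against the |U| − 1 forms v ↦ v_u + v_{u₀}, followed by cancelling repeated terms, leaves at
-- most |U| − 1 distinct good B with Σ 1_B ≡ 1_S modulo 1_U. Deleting q vertices of trace B for
-- each of them (pairwise disjoint, as the traces differ) lowers a_u by the number of chosen B
-- containing u, which makes the parity of a_u constant on U; hence all deg_W u agree modulo 2q.

open import Defs hiding (sym)
open import Algebra.Bundles using (CommutativeRing)
open import Data.Bool using (Bool; true; false; not; _∧_; _∨_; _xor_; if_then_else_)
open import Data.Bool.Properties as BoolP
  using (xor-∧-commutativeRing; xor-assoc; xor-comm; xor-identityˡ; xor-identityʳ; xor-same;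
         xor-annihilates-not; not-distribˡ-xor; not-distribʳ-xor; not-involutive; ∧-distribˡ-xor;
         ∧-zeroʳ; ∧-identityʳ; ∨-identityʳ; ¬-not)
open import Algebra.Properties.CommutativeSemigroup
  (CommutativeRing.+-commutativeSemigroup xor-∧-commutativeRing)
  using () renaming (interchange to xor-interchange)
open import Data.Fin using (Fin; zero; suc; _≟_)
open import Data.Fin.Subset using (Subset; _∈_; _∉_; _⊆_; _∪_; _∩_; _─_; _-_; ∣_∣; ⊥; ⁅_⁆; Nonempty)
open import Data.Fin.Subset.Properties
  using (_∈?_; nonempty?; ⊆-refl; ⊥⊆; ∉⊥; ∣⊥∣≡0; Empty-unique; ⊆-antisym; drop-∷-⊆; s⊆s;
         x∈⁅y⁆⇒x≡y; x∈p∪q⁻; x∈p∩q⁺; x∈p∩q⁻; p∩q⊆p; ∩-zeroˡ; ∩-distribʳ-∪; p─q⊆p;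
         x∈p∧x∉q⇒x∈p─q; x∈p∧x≢y⇒x∈p-y; x∈p⇒∣p-x∣<∣p∣)
open import Data.List using (List; []; _∷_; _++_; length; map)
open import Data.List.Relation.Unary.All as All using (All; []; _∷_)
open import Data.List.Relation.Unary.All.Properties as AllP using (¬Any⇒All¬)
open import Data.List.Relation.Unary.AllPairs using (AllPairs; []; _∷_)
open import Data.List.Relation.Unary.Any using (any?)
open import Data.Nat using (ℕ; zero; suc; _+_; _*_; _^_; _∸_; _%_; _/_; _≤_; z≤n; s≤s; NonZero)
open import Data.Nat.DivMod using (m≡m%n+[m/n]*n; [m+kn]%n≡m%n)
open import Data.Nat.ListAction using (sum)
open import Data.Nat.Properties
  using (≤-refl; ≤-reflexive; ≤-trans; m≤n⇒m≤1+n; ∸-monoˡ-≤; *-monoʳ-≤; +-identityʳ; +-suc; *-suc;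
         *-zeroʳ; *-distribʳ-+; m^n≢0)
open import Data.Nat.Solver using (module +-*-Solver)
open import Data.Product using (Σ; ∃; _×_; _,_; proj₁; proj₂)
open import Data.Sum using (_⊎_; inj₁; inj₂)
open import Data.Vec as Vec using (Vec; []; _∷_; lookup; tabulate; here; there)
open import Data.Vec.Properties
  using (zipWith-assoc; zipWith-comm; zipWith-identityˡ; zipWith-identityʳ; zipWith-inverseˡ; map-id;
         lookup-zipWith; lookup-replicate; lookup∘tabulate; []=⇒lookup; lookup⇒[]=; ≡-dec)
open import Data.Vec.Relation.Binary.Pointwise.Extensional using (ext; Pointwise-≡⇒≡)
import Data.Vec.Relation.Unary.All as VAll
import Data.Vec.Relation.Unary.All.Properties as VAllP
open import Function using (_∘_)
open import Relation.Binary.Construct.Closure.ReflexiveTransitive using (Star; ε; _◅_)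
open import Relation.Binary.PropositionalEquality
  using (_≡_; _≢_; refl; sym; trans; cong; cong₂; subst; module ≡-Reasoning)
open import Relation.Nullary using (yes; no)
open import Relation.Nullary.Decidable using (⌊_⌋)
open import Relation.Nullary.Negation using (contradiction)

open +-*-Solver using (solve; _:+_; _:*_; _:=_; con)

private
  variable
    n m k : ℕ
    a b X Y Z S U : Subset n
    L : List (Subset n)


-- 𝔽₂-vector space structure on subsets

xor-cancelˡ : ∀ x y → x xor (x xor y) ≡ y
xor-cancelˡ x y = trans (sym (xor-assoc x x y)) (cong (_xor y) (xor-same x))

xor≡false⇒≡ : ∀ {x y} → x xor y ≡ false → x ≡ y
xor≡false⇒≡ {false} {false} _  = refl
xor≡false⇒≡ {false} {true}  ()
xor≡false⇒≡ {true}  {false} ()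
xor≡false⇒≡ {true}  {true}  _  = refl

∨≡xor : ∀ x y → (x ≡ true → y ≡ false) → x ∨ y ≡ x xor y
∨≡xor true  y x⇒¬y = cong not (sym (x⇒¬y refl))
∨≡xor false y _    = refl

lookup-⊕ : ∀ (a b : Subset n) i → lookup (a ⊕ b) i ≡ lookup a i xor lookup b i
lookup-⊕ a b i = lookup-zipWith _xor_ i a b

lookup≡false⇒∉ : ∀ {p : Subset n} {x} → lookup p x ≡ false → x ∉ p
lookup≡false⇒∉ px≡false x∈p = contradiction (trans (sym ([]=⇒lookup x∈p)) px≡false) λ ()

⊕-assoc : ∀ (a b c : Subset n) → (a ⊕ b) ⊕ c ≡ a ⊕ (b ⊕ c)
⊕-assoc = zipWith-assoc xor-assoc

⊕-comm : ∀ (a b : Subset n) → a ⊕ b ≡ b ⊕ a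
⊕-comm = zipWith-comm xor-comm

⊕-identityˡ : ∀ (a : Subset n) → ⊥ ⊕ a ≡ a
⊕-identityˡ = zipWith-identityˡ xor-identityˡ

⊕-identityʳ : ∀ (a : Subset n) → a ⊕ ⊥ ≡ a
⊕-identityʳ = zipWith-identityʳ xor-identityʳ

⊕-self : ∀ (a : Subset n) → a ⊕ a ≡ ⊥
⊕-self a = trans (cong (_⊕ a) (sym (map-id a))) (zipWith-inverseˡ xor-same a)

⊕-cancelˡ : ∀ (a b : Subset n) → a ⊕ (a ⊕ b) ≡ b
⊕-cancelˡ a b = begin
  a ⊕ (a ⊕ b)  ≡⟨ ⊕-assoc a a b ⟨
  (a ⊕ a) ⊕ b  ≡⟨ cong (_⊕ b) (⊕-self a) ⟩
  ⊥ ⊕ b        ≡⟨ ⊕-identityˡ b ⟩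
  b            ∎
  where open ≡-Reasoning

⊕-cancelʳ : ∀ (a b : Subset n) → (a ⊕ b) ⊕ b ≡ a
⊕-cancelʳ a b = trans (⊕-assoc a b b) (trans (cong (a ⊕_) (⊕-self b)) (⊕-identityʳ a))

⊕-telescope : ∀ (a b c : Subset n) → (a ⊕ b) ⊕ (b ⊕ c) ≡ a ⊕ c
⊕-telescope a b c = trans (⊕-assoc a b (b ⊕ c)) (cong (a ⊕_) (⊕-cancelˡ b c))

⊕-swap : ∀ (a b c : Subset n) → a ⊕ (b ⊕ c) ≡ b ⊕ (a ⊕ c)
⊕-swap a b c = begin
  a ⊕ (b ⊕ c)  ≡⟨ ⊕-assoc a b c ⟨
  (a ⊕ b) ⊕ c  ≡⟨ cong (_⊕ c) (⊕-comm a b) ⟩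
  (b ⊕ a) ⊕ c  ≡⟨ ⊕-assoc b a c ⟩
  b ⊕ (a ⊕ c)  ∎
  where open ≡-Reasoning

⊕≡⇒≡⊕ : X ⊕ Y ≡ Z → X ≡ Y ⊕ Z
⊕≡⇒≡⊕ {X = X} {Y} refl = trans (sym (⊕-cancelˡ Y X)) (cong (Y ⊕_) (⊕-comm Y X))

sum⊕-++ : ∀ (L M : List (Subset n)) → sum⊕ (L ++ M) ≡ sum⊕ L ⊕ sum⊕ M
sum⊕-++ []      M = sym (⊕-identityˡ (sum⊕ M))
sum⊕-++ (B ∷ L) M = trans (cong (B ⊕_) (sum⊕-++ L M)) (sym (⊕-assoc B (sum⊕ L) (sum⊕ M)))

⊕-⊆ : a ⊆ U → b ⊆ U → a ⊕ b ⊆ U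
⊕-⊆ {a = a} {b = b} a⊆U b⊆U {x} x∈a⊕b with lookup a x in ax
... | true  = a⊆U (lookup⇒[]= x a ax)
... | false = b⊆U (lookup⇒[]= x b (trans (sym (cong (_xor lookup b x) ax))
                    (trans (sym (lookup-⊕ a b x)) ([]=⇒lookup x∈a⊕b))))

sum⊕-⊆ : All (_⊆ U) L → sum⊕ L ⊆ U
sum⊕-⊆ []          = ⊥⊆
sum⊕-⊆ (B⊆U ∷ L⊆U) = ⊕-⊆ B⊆U (sum⊕-⊆ L⊆U)

∪≡⊕ : Disjoint a b → a ∪ b ≡ a ⊕ b
∪≡⊕ {a = a} {b} a∩b≡∅ = Pointwise-≡⇒≡ (ext λ i → begin
  lookup (a ∪ b) i           ≡⟨ lookup-zipWith _∨_ i a b ⟩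
  lookup a i ∨ lookup b i    ≡⟨ ∨≡xor (lookup a i) (lookup b i) (λ ai → ¬-not (λ bi →
                                  a∩b≡∅ i (lookup⇒[]= i a ai) (lookup⇒[]= i b bi))) ⟩
  lookup a i xor lookup b i  ≡⟨ lookup-⊕ a b i ⟨
  lookup (a ⊕ b) i           ∎)
  where open ≡-Reasoning

elements : (p : Subset n) → Vec (Fin n) ∣ p ∣
elements []          = []
elements (true  ∷ p) = zero ∷ Vec.map suc (elements p)
elements (false ∷ p) = Vec.map suc (elements p)

elements-⊆ : ∀ (p : Subset n) → VAll.All (_∈ p) (elements p)
elements-⊆ []          = VAll.[]
elements-⊆ (true  ∷ p) = here VAll.∷ VAllP.map⁺ (VAll.map there (elements-⊆ p))
elements-⊆ (false ∷ p) = VAllP.map⁺ (VAll.map there (elements-⊆ p))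

All-elements : ∀ {P : Fin n → Set} {p : Subset n} → VAll.All P (elements p) → ∀ {x} → x ∈ p → P x
All-elements {p = true  ∷ p} (P0 VAll.∷ _)  here        = P0
All-elements {p = true  ∷ p} (_ VAll.∷ Ps)  (there x∈p) = All-elements (VAllP.map⁻ Ps) x∈p
All-elements {p = false ∷ p} Ps             (there x∈p) = All-elements (VAllP.map⁻ Ps) x∈p

sumSingletons : Vec (Fin n) m → Subset n
sumSingletons []       = ⊥
sumSingletons (x ∷ xs) = ⁅ x ⁆ ⊕ sumSingletons xs

sumSingletons-suc : ∀ (xs : Vec (Fin n) m) → sumSingletons (Vec.map suc xs) ≡ false ∷ sumSingletons xs
sumSingletons-suc []       = refl
sumSingletons-suc (x ∷ xs) = cong (⁅ suc x ⁆ ⊕_) (sumSingletons-suc xs)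

sumSingletons-elements : ∀ (p : Subset n) → sumSingletons (elements p) ≡ p
sumSingletons-elements []          = refl
sumSingletons-elements (true  ∷ p) = begin
  ⁅ zero ⁆ ⊕ sumSingletons (Vec.map suc (elements p))
    ≡⟨ cong (⁅ zero ⁆ ⊕_) (sumSingletons-suc (elements p)) ⟩
  true ∷ (⊥ ⊕ sumSingletons (elements p))
    ≡⟨ cong (true ∷_) (trans (⊕-identityˡ _) (sumSingletons-elements p)) ⟩
  true ∷ p ∎
  where open ≡-Reasoning
sumSingletons-elements (false ∷ p) =
  trans (sumSingletons-suc (elements p)) (cong (false ∷_) (sumSingletons-elements p))


odd : ℕ → Bool
odd zero    = false
odd (suc m) = not (odd m)

bit : Bool → ℕ
bit b = if b then 1 else 0

odd-+ : ∀ m n → odd (m + n) ≡ odd m xor odd n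
odd-+ zero    n = refl
odd-+ (suc m) n = trans (cong not (odd-+ m n)) (not-distribˡ-xor (odd m) (odd n))

odd-2* : ∀ j → odd (2 * j) ≡ false
odd-2* j = begin
  odd (j + (j + 0))         ≡⟨ odd-+ j (j + 0) ⟩
  odd j xor odd (j + 0)     ≡⟨ cong (λ i → odd j xor odd i) (+-identityʳ j) ⟩
  odd j xor odd j           ≡⟨ xor-same (odd j) ⟩
  false                     ∎
  where open ≡-Reasoning

odd-1+2* : ∀ j → odd (1 + 2 * j) ≡ true
odd-1+2* j = cong not (odd-2* j)

odd-split : ∀ m → ∃ λ j → m ≡ bit (odd m) + 2 * j
odd-split zero = 0 , refl
odd-split (suc m) with odd-split m
... | j , m≡ with odd m
...   | false = j , cong suc m≡
...   | true  = suc j , trans (cong suc m≡) (cong suc (sym (+-suc j (j + 0))))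

odd≡⇒split : ∀ {m b} → odd m ≡ b → ∃ λ j → m ≡ bit b + 2 * j
odd≡⇒split {m} odd≡b with odd-split m
... | j , m≡ = j , trans m≡ (cong (λ b → bit b + 2 * j) odd≡b)

odd-∣⊕∣ : ∀ (a b : Subset n) → odd ∣ a ⊕ b ∣ ≡ odd ∣ a ∣ xor odd ∣ b ∣
odd-∣⊕∣ []          []          = refl
odd-∣⊕∣ (true  ∷ a) (true  ∷ b) =
  trans (odd-∣⊕∣ a b) (sym (xor-annihilates-not (odd ∣ a ∣) (odd ∣ b ∣)))
odd-∣⊕∣ (true  ∷ a) (false ∷ b) =
  trans (cong not (odd-∣⊕∣ a b)) (not-distribˡ-xor (odd ∣ a ∣) (odd ∣ b ∣))
odd-∣⊕∣ (false ∷ a) (true  ∷ b) =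
  trans (cong not (odd-∣⊕∣ a b)) (not-distribʳ-xor (odd ∣ a ∣) (odd ∣ b ∣))
odd-∣⊕∣ (false ∷ a) (false ∷ b) = odd-∣⊕∣ a b

multiplicity : List (Subset n) → Fin n → ℕ
multiplicity Bs u = sum (map (λ B → bit (lookup B u)) Bs)

odd-multiplicity : ∀ (Bs : List (Subset n)) u → odd (multiplicity Bs u) ≡ lookup (sum⊕ Bs) u
odd-multiplicity []       u = sym (lookup-replicate u false)
odd-multiplicity (B ∷ Bs) u = begin
  odd (bit (lookup B u) + multiplicity Bs u)
    ≡⟨ odd-+ (bit (lookup B u)) (multiplicity Bs u) ⟩
  odd (bit (lookup B u)) xor odd (multiplicity Bs u)
    ≡⟨ cong₂ _xor_ (odd-bit (lookup B u)) (odd-multiplicity Bs u) ⟩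
  lookup B u xor lookup (sum⊕ Bs) u
    ≡⟨ lookup-⊕ B (sum⊕ Bs) u ⟨
  lookup (B ⊕ sum⊕ Bs) u ∎
  where
  open ≡-Reasoning
  odd-bit : ∀ b → odd (bit b) ≡ b
  odd-bit true  = refl
  odd-bit false = refl


-- Linear forms and Gaussian elimination over 𝔽₂

record LinearForm (n : ℕ) : Set where
  field
    apply    : Subset n → Bool
    additive : ∀ a b → apply (a ⊕ b) ≡ apply a xor apply b
open LinearForm public

Vanishes : LinearForm n → Subset n → Set
Vanishes φ v = apply φ v ≡ false

module _ (φ : LinearForm n) where

  apply-⊥ : Vanishes φ ⊥
  apply-⊥ = begin
    apply φ ⊥                  ≡⟨ cong (apply φ) (⊕-identityˡ ⊥) ⟨
    apply φ (⊥ ⊕ ⊥)            ≡⟨ additive φ ⊥ ⊥ ⟩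
    apply φ ⊥ xor apply φ ⊥    ≡⟨ xor-same (apply φ ⊥) ⟩
    false                      ∎
    where open ≡-Reasoning

  apply-sum⊕ : All (Vanishes φ) L → Vanishes φ (sum⊕ L)
  apply-sum⊕ []                    = apply-⊥
  apply-sum⊕ {L = v ∷ L} (φv ∷ φL) =
    trans (additive φ v (sum⊕ L)) (cong₂ _xor_ φv (apply-sum⊕ φL))

  pivot : ∀ {P : Subset n → Set} (L : List (Subset n)) → All P L →
          (∃ λ p → P p × apply φ p ≡ true) ⊎ All (Vanishes φ) L
  pivot L PL with any? (λ v → apply φ v BoolP.≟ true) L
  ... | yes hit  = inj₁ (_ , All.lookupAny PL hit)
  ... | no  miss = inj₂ (All.map ¬-not (¬Any⇒All¬ L miss))

-- Row reduction of ψ by the pivot p of φ: ψ + ψ(p)·φ.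
shear : LinearForm n → Subset n → LinearForm n → LinearForm n
shear φ p ψ .apply v = apply ψ v xor (apply ψ p ∧ apply φ v)
shear φ p ψ .additive a b = begin
  apply ψ (a ⊕ b) xor (ψp ∧ apply φ (a ⊕ b))
    ≡⟨ cong₂ (λ x y → x xor (ψp ∧ y)) (additive ψ a b) (additive φ a b) ⟩
  (apply ψ a xor apply ψ b) xor (ψp ∧ (apply φ a xor apply φ b))
    ≡⟨ cong ((apply ψ a xor apply ψ b) xor_) (∧-distribˡ-xor ψp (apply φ a) (apply φ b)) ⟩
  (apply ψ a xor apply ψ b) xor ((ψp ∧ apply φ a) xor (ψp ∧ apply φ b))
    ≡⟨ xor-interchange (apply ψ a) (apply ψ b) (ψp ∧ apply φ a) (ψp ∧ apply φ b) ⟩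
  (apply ψ a xor (ψp ∧ apply φ a)) xor (apply ψ b xor (ψp ∧ apply φ b)) ∎
  where
  open ≡-Reasoning
  ψp : Bool
  ψp = apply ψ p

shear-on-kernel : ∀ (φ : LinearForm n) p ψ {v} → Vanishes φ v → apply (shear φ p ψ) v ≡ apply ψ v
shear-on-kernel φ p ψ {v} φv = begin
  apply ψ v xor (apply ψ p ∧ apply φ v)  ≡⟨ cong (λ y → apply ψ v xor (apply ψ p ∧ y)) φv ⟩
  apply ψ v xor (apply ψ p ∧ false)      ≡⟨ cong (apply ψ v xor_) (∧-zeroʳ (apply ψ p)) ⟩
  apply ψ v xor false                    ≡⟨ xor-identityʳ (apply ψ v) ⟩
  apply ψ v                              ∎
  where open ≡-Reasoning

shear-off-kernel : ∀ (φ : LinearForm n) p ψ {v} → apply φ v ≡ true →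
                   apply (shear φ p ψ) v ≡ apply ψ (p ⊕ v)
shear-off-kernel φ p ψ {v} φv = begin
  apply ψ v xor (apply ψ p ∧ apply φ v)  ≡⟨ cong (λ y → apply ψ v xor (apply ψ p ∧ y)) φv ⟩
  apply ψ v xor (apply ψ p ∧ true)       ≡⟨ cong (apply ψ v xor_) (∧-identityʳ (apply ψ p)) ⟩
  apply ψ v xor apply ψ p                ≡⟨ xor-comm (apply ψ v) (apply ψ p) ⟩
  apply ψ p xor apply ψ v                ≡⟨ additive ψ p v ⟨
  apply ψ (p ⊕ v)                        ∎
  where open ≡-Reasoning

-- Gaussian elimination; vanishing on ΣL′ ⊕ ΣL means that each form of Φ takes the same value
-- on both sums.
eliminate : ∀ {P : Subset n → Set} (Φ : Vec (LinearForm n) k) (L : List (Subset n)) → All P L →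
            Σ (List (Subset n)) λ L′ → All P L′ × length L′ ≤ k ×
              VAll.All (λ φ → Vanishes φ (sum⊕ L′ ⊕ sum⊕ L)) Φ
eliminate [] L PL = [] , [] , z≤n , VAll.[]
eliminate (φ ∷ Φ) L PL with pivot φ L PL
... | inj₂ L⊆kerφ with eliminate Φ L (All.zip (PL , L⊆kerφ))
...   | L′ , PL′ , len , ker = L′ , All.map proj₁ PL′ , m≤n⇒m≤1+n len , φd VAll.∷ ker
  where
  φd : Vanishes φ (sum⊕ L′ ⊕ sum⊕ L)
  φd = trans (additive φ (sum⊕ L′) (sum⊕ L))
             (cong₂ _xor_ (apply-sum⊕ φ (All.map proj₂ PL′)) (apply-sum⊕ φ L⊆kerφ))
eliminate (φ ∷ Φ) L PL | inj₁ (p , Pp , φp) with eliminate (Vec.map (shear φ p) Φ) L PL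
... | L′ , PL′ , len , ker with apply φ (sum⊕ L′ ⊕ sum⊕ L) in φd
...   | false = L′ , PL′ , m≤n⇒m≤1+n len , φd VAll.∷ VAll.map (λ {ψ} → keep {ψ}) (VAllP.map⁻ ker)
  where
  keep : ∀ {ψ} → Vanishes (shear φ p ψ) (sum⊕ L′ ⊕ sum⊕ L) → Vanishes ψ (sum⊕ L′ ⊕ sum⊕ L)
  keep {ψ} ψ′d = trans (sym (shear-on-kernel φ p ψ φd)) ψ′d
...   | true  = p ∷ L′ , Pp ∷ PL′ , s≤s len , φd′ VAll.∷ VAll.map (λ {ψ} → add {ψ}) (VAllP.map⁻ ker)
  where
  d′≡ : sum⊕ (p ∷ L′) ⊕ sum⊕ L ≡ p ⊕ (sum⊕ L′ ⊕ sum⊕ L)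
  d′≡ = ⊕-assoc p (sum⊕ L′) (sum⊕ L)
  φd′ : Vanishes φ (sum⊕ (p ∷ L′) ⊕ sum⊕ L)
  φd′ = trans (cong (apply φ) d′≡) (trans (additive φ p _) (cong₂ _xor_ φp φd))
  add : ∀ {ψ} → Vanishes (shear φ p ψ) (sum⊕ L′ ⊕ sum⊕ L) → Vanishes ψ (sum⊕ (p ∷ L′) ⊕ sum⊕ L)
  add {ψ} ψ′d = trans (cong (apply ψ) d′≡) (trans (sym (shear-off-kernel φ p ψ φd)) ψ′d)

toggle : Subset n → List (Subset n) → List (Subset n)
toggle x []       = x ∷ []
toggle x (y ∷ ys) with ≡-dec BoolP._≟_ x y
... | yes _ = ys
... | no  _ = y ∷ toggle x ys

module _ (x : Subset n) where

  sum⊕-toggle : ∀ ys → sum⊕ (toggle x ys) ≡ x ⊕ sum⊕ ys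
  sum⊕-toggle []       = refl
  sum⊕-toggle (y ∷ ys) with ≡-dec BoolP._≟_ x y
  ... | yes refl = sym (⊕-cancelˡ x (sum⊕ ys))
  ... | no  _    = trans (cong (y ⊕_) (sum⊕-toggle ys)) (⊕-swap y x (sum⊕ ys))

  All-toggle : ∀ {P : Subset n → Set} {ys} → P x → All P ys → All P (toggle x ys)
  All-toggle {ys = []}     Px []         = Px ∷ []
  All-toggle {ys = y ∷ ys} Px (Py ∷ Pys) with ≡-dec BoolP._≟_ x y
  ... | yes _ = Pys
  ... | no  _ = Py ∷ All-toggle Px Pys

  length-toggle : ∀ ys → length (toggle x ys) ≤ suc (length ys)
  length-toggle []       = s≤s z≤n
  length-toggle (y ∷ ys) with ≡-dec BoolP._≟_ x y
  ... | yes _ = m≤n⇒m≤1+n (m≤n⇒m≤1+n ≤-refl)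
  ... | no  _ = s≤s (length-toggle ys)

  distinct-toggle : ∀ {ys} → AllPairs _≢_ ys → AllPairs _≢_ (toggle x ys)
  distinct-toggle {[]}     []           = [] ∷ []
  distinct-toggle {y ∷ ys} (y∉ys ∷ ys!) with ≡-dec BoolP._≟_ x y
  ... | yes _   = ys!
  ... | no  x≢y = All-toggle (x≢y ∘ sym) y∉ys ∷ distinct-toggle ys!

cancel-duplicates : ∀ {P : Subset n → Set} {L} → All P L →
  Σ (List (Subset n)) λ L′ →
    All P L′ × AllPairs _≢_ L′ × length L′ ≤ length L × sum⊕ L′ ≡ sum⊕ L
cancel-duplicates []         = [] , [] , [] , z≤n , refl
cancel-duplicates {L = x ∷ L} (Px ∷ PL) with cancel-duplicates PL
... | L′ , PL′ , L′! , len , sum≡ =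
  toggle x L′ , All-toggle x Px PL′ , distinct-toggle x L′! ,
  ≤-trans (length-toggle x L′) (s≤s len) , trans (sum⊕-toggle x L′) (cong (x ⊕_) sum≡)


-- The quotient 𝔽₂^U / ⟨1_U⟩

infix 4 _≡_mod⟨_⟩
_≡_mod⟨_⟩ : Subset n → Subset n → Subset n → Set
X ≡ S mod⟨ U ⟩ = X ≡ S ⊎ X ≡ S ⊕ U

≡mod-trans : X ≡ Y mod⟨ U ⟩ → Y ≡ S mod⟨ U ⟩ → X ≡ S mod⟨ U ⟩
≡mod-trans (inj₁ refl)           Y≡S           = Y≡S
≡mod-trans (inj₂ refl)           (inj₁ refl)   = inj₂ refl
≡mod-trans {U = U} (inj₂ refl) (inj₂ Y≡S⊕U) = inj₁ (trans (cong (_⊕ U) Y≡S⊕U) (⊕-cancelʳ _ U))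

⊕≡⊥∨U⇒≡mod : X ⊕ Y ≡ ⊥ ⊎ X ⊕ Y ≡ U → X ≡ Y mod⟨ U ⟩
⊕≡⊥∨U⇒≡mod {Y = Y} (inj₁ X⊕Y≡⊥) = inj₁ (trans (⊕≡⇒≡⊕ X⊕Y≡⊥) (⊕-identityʳ Y))
⊕≡⊥∨U⇒≡mod         (inj₂ X⊕Y≡U) = inj₂ (⊕≡⇒≡⊕ X⊕Y≡U)

≡mod⇒pointwise : X ≡ S mod⟨ U ⟩ → ∃ λ c → ∀ {u} → u ∈ U → lookup X u ≡ lookup S u xor c
≡mod⇒pointwise {S = S} (inj₁ refl) = false , λ {u} _ → sym (xor-identityʳ (lookup S u))
≡mod⇒pointwise {S = S} {U} (inj₂ refl) = true , λ {u} u∈U →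
  trans (lookup-⊕ S U u) (cong (lookup S u xor_) ([]=⇒lookup u∈U))

differenceForm : Fin n → Fin n → LinearForm n
differenceForm u₀ u .apply v = lookup v u xor lookup v u₀
differenceForm u₀ u .additive a b =
  trans (cong₂ _xor_ (lookup-⊕ a b u) (lookup-⊕ a b u₀))
        (xor-interchange (lookup a u) (lookup b u) (lookup a u₀) (lookup b u₀))

differenceForms : (U : Subset n) (u₀ : Fin n) → Vec (LinearForm n) ∣ U - u₀ ∣
differenceForms U u₀ = Vec.map (differenceForm u₀) (elements (U - u₀))

module _ {U : Subset n} {u₀ : Fin n} {d : Subset n}
         (ker : VAll.All (λ φ → Vanishes φ d) (differenceForms U u₀)) where

  kernel-constant : ∀ {u} → u ∈ U → lookup d u ≡ lookup d u₀
  kernel-constant {u} u∈U with u ≟ u₀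
  ... | yes refl = refl
  ... | no  u≢u₀ = xor≡false⇒≡ (All-elements (VAllP.map⁻ ker) (x∈p∧x≢y⇒x∈p-y u∈U u≢u₀))

  kernel-differenceForms : d ⊆ U → d ≡ ⊥ ⊎ d ≡ U
  kernel-differenceForms d⊆U with lookup d u₀ in du₀
  ... | false = inj₁ (Empty-unique λ (x , x∈d) →
                  lookup≡false⇒∉ (trans (kernel-constant (d⊆U x∈d)) du₀) x∈d)
  ... | true  = inj₂ (⊆-antisym d⊆U λ {u} u∈U → lookup⇒[]= u d (trans (kernel-constant u∈U) du₀))

-- The |U − u₀| = dim 𝔽₂^U/⟨1_U⟩ difference forms detect classes modulo ⟨1_U⟩, so eliminating
-- against them keeps at most that many terms.
shorten-mod : ∀ {P : Subset n → Set} (u₀ : Fin n) {L} → (∀ {B} → P B → B ⊆ U) → All P L →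
  sum⊕ L ≡ S mod⟨ U ⟩ →
  Σ (List (Subset n)) λ L′ →
    All P L′ × AllPairs _≢_ L′ × length L′ ≤ ∣ U - u₀ ∣ × sum⊕ L′ ≡ S mod⟨ U ⟩
shorten-mod {U = U} u₀ {L} P⇒⊆U PL L≡S with eliminate (differenceForms U u₀) L PL
... | L′ , PL′ , len , ker with cancel-duplicates PL′
...   | L″ , PL″ , L″! , len′ , L″≡L′ =
  L″ , PL″ , L″! , ≤-trans len′ len ,
  ≡mod-trans (⊕≡⊥∨U⇒≡mod (kernel-differenceForms ker″ d⊆U)) L≡S
  where
  ker″ : VAll.All (λ φ → Vanishes φ (sum⊕ L″ ⊕ sum⊕ L)) (differenceForms U u₀)
  ker″ = subst (λ X → VAll.All (λ φ → Vanishes φ (X ⊕ sum⊕ L)) (differenceForms U u₀))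
               (sym L″≡L′) ker
  d⊆U : sum⊕ L″ ⊕ sum⊕ L ⊆ U
  d⊆U = ⊕-⊆ (sum⊕-⊆ (All.map P⇒⊆U PL″)) (sum⊕-⊆ (All.map P⇒⊆U PL))


Disjoint-∷⁻ : ∀ {x y} → Disjoint (x ∷ a) (y ∷ b) → Disjoint a b
Disjoint-∷⁻ a∩b≡∅ i i∈a i∈b = a∩b≡∅ (suc i) (there i∈a) (there i∈b)

∣∪∣-disjoint : Disjoint a b → ∣ a ∪ b ∣ ≡ ∣ a ∣ + ∣ b ∣
∣∪∣-disjoint {a = []}        {[]}        _     = refl
∣∪∣-disjoint {a = true ∷ a}  {true ∷ b}  a∩b≡∅ = contradiction here (a∩b≡∅ zero here)
∣∪∣-disjoint {a = true ∷ a}  {false ∷ b} a∩b≡∅ = cong suc (∣∪∣-disjoint (Disjoint-∷⁻ a∩b≡∅))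
∣∪∣-disjoint {a = false ∷ a} {true ∷ b}  a∩b≡∅ =
  trans (cong suc (∣∪∣-disjoint (Disjoint-∷⁻ a∩b≡∅))) (sym (+-suc ∣ a ∣ ∣ b ∣))
∣∪∣-disjoint {a = false ∷ a} {false ∷ b} a∩b≡∅ = ∣∪∣-disjoint (Disjoint-∷⁻ a∩b≡∅)

∣∪∩∣-disjoint : ∀ r → Disjoint a b → ∣ (a ∪ b) ∩ r ∣ ≡ ∣ a ∩ r ∣ + ∣ b ∩ r ∣
∣∪∩∣-disjoint {a = a} {b} r a∩b≡∅ =
  trans (cong ∣_∣ (∩-distribʳ-∪ r a b))
        (∣∪∣-disjoint (λ x x∈a∩r x∈b∩r → a∩b≡∅ x (p∩q⊆p a r x∈a∩r) (p∩q⊆p b r x∈b∩r)))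

─-Disjoint : Disjoint (a ─ b) b
─-Disjoint {a = true ∷ a}  {false ∷ b} zero    here        ()
─-Disjoint {a = false ∷ a} {false ∷ b} zero    ()
─-Disjoint {a = _ ∷ a}     {true ∷ b}  zero    ()
─-Disjoint {a = _ ∷ a}     {_ ∷ b}     (suc x) (there x∈) (there x∈b) = ─-Disjoint x x∈ x∈b

─∪-⊆ : b ⊆ a → (a ─ b) ∪ b ≡ a
─∪-⊆ {b = []}       {[]}    _   = refl
─∪-⊆ {b = true ∷ b}  {x ∷ a} b⊆a = cong₂ _∷_ (sym ([]=⇒lookup (b⊆a here))) (─∪-⊆ (drop-∷-⊆ b⊆a))
─∪-⊆ {b = false ∷ b} {x ∷ a} b⊆a = cong₂ _∷_ (∨-identityʳ x) (─∪-⊆ (drop-∷-⊆ b⊆a))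

∣∩∣-split : b ⊆ a → ∀ r → ∣ a ∩ r ∣ ≡ ∣ (a ─ b) ∩ r ∣ + ∣ b ∩ r ∣
∣∩∣-split {b = b} {a} b⊆a r =
  trans (cong (λ s → ∣ s ∩ r ∣) (sym (─∪-⊆ b⊆a))) (∣∪∩∣-disjoint r (─-Disjoint {a = a}))

Disjoint-⋃ : ∀ {P} {Ps : List (Subset n)} → All (Disjoint P) Ps → Disjoint P (⋃ Ps)
Disjoint-⋃ []                 x x∈P = ∉⊥
Disjoint-⋃ {Ps = R ∷ Ps} (P∩R≡∅ ∷ rest) x x∈P x∈R∪ with x∈p∪q⁻ R (⋃ Ps) x∈R∪
... | inj₁ x∈R = P∩R≡∅ x x∈P x∈R
... | inj₂ x∈⋃ = Disjoint-⋃ rest x x∈P x∈⋃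

subset-of-size : ∀ (X : Subset n) {k} → k ≤ ∣ X ∣ → Σ (Subset n) λ P → P ⊆ X × ∣ P ∣ ≡ k
subset-of-size {n} X {zero} _ = ⊥ , ⊥⊆ , ∣⊥∣≡0 n
subset-of-size (true ∷ X) {suc k} (s≤s k≤∣X∣) =
  let P , P⊆X , ∣P∣≡k = subset-of-size X k≤∣X∣ in true ∷ P , s⊆s P⊆X , cong suc ∣P∣≡k
subset-of-size (false ∷ X) {suc k} k<∣X∣ =
  let P , P⊆X , ∣P∣≡k = subset-of-size X k<∣X∣ in false ∷ P , s⊆s P⊆X , ∣P∣≡k

∣p-x∣≤∣p∣∸1 : ∀ {p : Subset n} {x} → x ∈ p → ∣ p - x ∣ ≤ ∣ p ∣ ∸ 1
∣p-x∣≤∣p∣∸1 x∈p = ∸-monoˡ-≤ 1 (x∈p⇒∣p-x∣<∣p∣ x∈p)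

nonempty : ∀ {p : Subset n} → 1 ≤ ∣ p ∣ → Nonempty p
nonempty {n} {p} 1≤∣p∣ with nonempty? p
... | yes p≢∅ = p≢∅
... | no  p≡∅ =
  contradiction (subst (1 ≤_) (trans (cong ∣_∣ (Empty-unique p≡∅)) (∣⊥∣≡0 n)) 1≤∣p∣) λ ()

〔mod〕-sym : ∀ {x y d} → x ≡ y 〔mod d 〕 → y ≡ x 〔mod d 〕
〔mod〕-sym (s , t , e) = t , s , sym e

〔mod〕-trans : ∀ {x y z d} → x ≡ y 〔mod d 〕 → y ≡ z 〔mod d 〕 → x ≡ z 〔mod d 〕
〔mod〕-trans {x} {y} {z} {d} (s , t , x+sd≡y+td) (s′ , t′ , y+s′d≡z+t′d) = s + s′ , t′ + t , (begin
  x + (s + s′) * d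
    ≡⟨ solve 4 (λ x s s′ d → x :+ (s :+ s′) :* d := (x :+ s :* d) :+ s′ :* d) refl x s s′ d ⟩
  (x + s * d) + s′ * d
    ≡⟨ cong (_+ s′ * d) x+sd≡y+td ⟩
  (y + t * d) + s′ * d
    ≡⟨ solve 4 (λ y t s′ d → (y :+ t :* d) :+ s′ :* d := (y :+ s′ :* d) :+ t :* d) refl y t s′ d ⟩
  (y + s′ * d) + t * d
    ≡⟨ cong (_+ t * d) y+s′d≡z+t′d ⟩
  (z + t′ * d) + t * d
    ≡⟨ solve 4 (λ z t′ t d → (z :+ t′ :* d) :+ t :* d := z :+ (t′ :+ t) :* d) refl z t′ t d ⟩
  z + (t′ + t) * d ∎)
  where open ≡-Reasoning

〔mod〕⇒%≡ : ∀ {x y d} .{{_ : NonZero d}} → x ≡ y 〔mod d 〕 → x % d ≡ y % d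
〔mod〕⇒%≡ {x} {y} {d} (s , t , x+sd≡y+td) = begin
  x % d            ≡⟨ [m+kn]%n≡m%n x s d ⟨
  (x + s * d) % d  ≡⟨ cong (_% d) x+sd≡y+td ⟩
  (y + t * d) % d  ≡⟨ [m+kn]%n≡m%n y t d ⟩
  y % d            ∎
  where open ≡-Reasoning

lift-to-2q : ∀ {w} c r a q k → w + c * q ≡ r + a * q → (∃ λ j → a + c ≡ k + 2 * j) →
             w ≡ r + k * q 〔mod 2 * q 〕
lift-to-2q {w} c r a q k w+cq≡r+aq (j , a+c≡k+2j) = c , j , (begin
  w + c * (2 * q)
    ≡⟨ solve 3 (λ w c q → w :+ c :* (con 2 :* q) := (w :+ c :* q) :+ c :* q) refl w c q ⟩
  (w + c * q) + c * q
    ≡⟨ cong (_+ c * q) w+cq≡r+aq ⟩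
  (r + a * q) + c * q
    ≡⟨ solve 4 (λ r a c q → (r :+ a :* q) :+ c :* q := r :+ (a :+ c) :* q) refl r a c q ⟩
  r + (a + c) * q
    ≡⟨ cong (λ t → r + t * q) a+c≡k+2j ⟩
  r + (k + 2 * j) * q
    ≡⟨ solve 4 (λ r k j q → r :+ (k :+ con 2 :* j) :* q := (r :+ k :* q) :+ j :* (con 2 :* q))
               refl r k j q ⟩
  (r + k * q) + j * (2 * q) ∎)
  where open ≡-Reasoning


-- Good traces, deletion blocks and the doubled modulus

N-sym : ∀ (G : Graph n) {x u} → x ∈ N G u → u ∈ N G x
N-sym G {x} {u} x∈Nu = lookup⇒[]= u (N G x) (begin
  lookup (N G x) u  ≡⟨ lookup∘tabulate (adj G x) u ⟩
  adj G x u         ≡⟨ Graph.sym G x u ⟩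
  adj G u x         ≡⟨ lookup∘tabulate (adj G u) x ⟨
  lookup (N G u) x  ≡⟨ []=⇒lookup x∈Nu ⟩
  true              ∎)
  where open ≡-Reasoning

module Spanning (G : Graph n) (q : ℕ) (A U : Subset n) where

  Good : Subset n → Set
  Good B = B ⊆ U × q ≤ count G A U B

  Spanned : Subset n → Set
  Spanned X = Σ (List (Subset n)) λ L → All Good L × sum⊕ L ≡ X

  Good⇒Spanned : Good X → Spanned X
  Good⇒Spanned {X} goodX = X ∷ [] , goodX ∷ [] , ⊕-identityʳ X

  Spanned-⊕ : Spanned X → Spanned Y → Spanned (X ⊕ Y)
  Spanned-⊕ (L , goodL , refl) (M , goodM , refl) = L ++ M , AllP.++⁺ goodL goodM , sum⊕-++ L M

  edge-Spanned : ∀ {x y} → H₂Edge G q A U x y → Spanned (⁅ x ⁆ ⊕ ⁅ y ⁆)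
  edge-Spanned {x} {y} (x∈U , y∈U , x≢y , many) =
    subst Spanned (∪≡⊕ disjoint) (Good⇒Spanned (pair⊆U , many))
    where
    disjoint : Disjoint ⁅ x ⁆ ⁅ y ⁆
    disjoint i i∈⁅x⁆ i∈⁅y⁆ = x≢y (trans (sym (x∈⁅y⁆⇒x≡y x i∈⁅x⁆)) (x∈⁅y⁆⇒x≡y y i∈⁅y⁆))
    pair⊆U : ⁅ x ⁆ ∪ ⁅ y ⁆ ⊆ U
    pair⊆U i∈ with x∈p∪q⁻ ⁅ x ⁆ ⁅ y ⁆ i∈
    ... | inj₁ i∈⁅x⁆ = subst (_∈ U) (sym (x∈⁅y⁆⇒x≡y x i∈⁅x⁆)) x∈U
    ... | inj₂ i∈⁅y⁆ = subst (_∈ U) (sym (x∈⁅y⁆⇒x≡y y i∈⁅y⁆)) y∈U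

  walk-Spanned : ∀ {x y} → Star (H₂Edge G q A U) x y → Spanned (⁅ x ⁆ ⊕ ⁅ y ⁆)
  walk-Spanned {x} ε = [] , [] , sym (⊕-self ⁅ x ⁆)
  walk-Spanned {x} {y} (_◅_ {j = z} xz zy) =
    subst Spanned (⊕-telescope ⁅ x ⁆ ⁅ z ⁆ ⁅ y ⁆) (Spanned-⊕ (edge-Spanned xz) (walk-Spanned zy))

  module _ (connected : H₂Connected G q A U) where

    even-Spanned : ∀ (xs : Vec (Fin n) m) → VAll.All (_∈ U) xs → odd m ≡ false →
                   Spanned (sumSingletons xs)
    even-Spanned []           VAll.[]                         _    = [] , [] , refl
    even-Spanned (x ∷ [])     _                               ()
    even-Spanned (x ∷ y ∷ xs) (x∈U VAll.∷ y∈U VAll.∷ xs⊆U) even =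
      subst Spanned (⊕-assoc ⁅ x ⁆ ⁅ y ⁆ (sumSingletons xs))
        (Spanned-⊕ (walk-Spanned (connected x y x∈U y∈U))
                   (even-Spanned xs xs⊆U (trans (sym (not-involutive _)) even)))

    even-subset-Spanned : S ⊆ U → odd ∣ S ∣ ≡ false → Spanned S
    even-subset-Spanned {S} S⊆U even =
      subst Spanned (sumSingletons-elements S)
        (even-Spanned (elements S) (VAll.map S⊆U (elements-⊆ S)) even)

    -- An odd S is made even by adding U when |U| is odd, and the odd good set C otherwise.
    spans-quotient :
      ((∃ λ j → ∣ U ∣ ≡ 2 * j) →
        Σ (Subset n) λ C → C ⊆ U × (∃ λ j → ∣ C ∣ ≡ 1 + 2 * j) × q ≤ count G A U C) →
      S ⊆ U → Σ (List (Subset n)) λ L → All Good L × sum⊕ L ≡ S mod⟨ U ⟩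
    spans-quotient {S} oddGood S⊆U with odd ∣ S ∣ in oddS | odd ∣ U ∣ in oddU
    ... | false | _ = let L , goodL , L≡S = even-subset-Spanned S⊆U oddS in L , goodL , inj₁ L≡S
    ... | true | true =
      let L , goodL , L≡S⊕U = even-subset-Spanned (⊕-⊆ S⊆U ⊆-refl)
                                (trans (odd-∣⊕∣ S U) (cong₂ _xor_ oddS oddU))
      in L , goodL , inj₂ L≡S⊕U
    ... | true | false =
      let C , C⊆U , (j , ∣C∣≡) , many = oddGood (odd≡⇒split oddU)
          oddC = trans (cong odd ∣C∣≡) (odd-1+2* j)
          S⊕C = even-subset-Spanned (⊕-⊆ S⊆U C⊆U) (trans (odd-∣⊕∣ S C) (cong₂ _xor_ oddS oddC))
          L , goodL , L≡S = Spanned-⊕ S⊕C (Good⇒Spanned (C⊆U , many))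
      in L , goodL , inj₁ (trans L≡S (⊕-cancelʳ S C))

module Deletion (G : Graph n) (q : ℕ) (A U : Subset n) where

  -- The set counted by count G A U B, so that ∣ withTrace B ∣ is count G A U B by definition.
  withTrace : Subset n → Subset n
  withTrace B = tabulate (λ x → ⌊ x ∈? (A ─ U) ⌋ ∧ ⌊ ≡-dec BoolP._≟_ (trace G U x) B ⌋)

  ∈withTrace⁻ : ∀ {x B} → x ∈ withTrace B → x ∈ A ─ U × trace G U x ≡ B
  ∈withTrace⁻ {x} {B} x∈ with x ∈? (A ─ U) | ≡-dec BoolP._≟_ (trace G U x) B
                              | trans (sym (lookup∘tabulate _ x)) ([]=⇒lookup x∈)
  ... | yes x∈A─U | yes trace≡B | _ = x∈A─U , trace≡B
  ... | yes _     | no _        | ()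
  ... | no _      | _           | ()

  record Block (B : Subset n) : Set where
    field
      members   : Subset n
      size      : ∣ members ∣ ≡ q
      members⊆  : members ⊆ withTrace B
  open Block

  block : ∀ {B} → q ≤ count G A U B → Block B
  block {B} many = let P , P⊆ , ∣P∣≡q = subset-of-size (withTrace B) many in record
    { members = P ; size = ∣P∣≡q ; members⊆ = P⊆ }

  trace-of : ∀ {B} (b : Block B) {x} → x ∈ members b → trace G U x ≡ B
  trace-of b x∈ = proj₂ (∈withTrace⁻ (members⊆ b x∈))

  blockMembers : ∀ {Bs} → All Block Bs → List (Subset n)
  blockMembers = All.reduce members

  ⋃blockMembers⊆ : ∀ {Bs} (bs : All Block Bs) → ⋃ (blockMembers bs) ⊆ A ─ U
  ⋃blockMembers⊆ []       x∈ = contradiction x∈ ∉⊥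
  ⋃blockMembers⊆ (b ∷ bs) x∈ with x∈p∪q⁻ (members b) _ x∈
  ... | inj₁ x∈b    = proj₁ (∈withTrace⁻ (members⊆ b x∈b))
  ... | inj₂ x∈rest = ⋃blockMembers⊆ bs x∈rest

  blockMembers-shape : ∀ {Bs} (bs : All Block Bs) →
    All (λ P → ∣ P ∣ ≡ q × (Σ (Subset n) λ B → ∀ x → x ∈ P → trace G U x ≡ B)) (blockMembers bs)
  blockMembers-shape []       = []
  blockMembers-shape (b ∷ bs) = (size b , _ , λ x → trace-of b) ∷ blockMembers-shape bs

  blockMembers-disjoint : ∀ {Bs} (bs : All Block Bs) → AllPairs _≢_ Bs →
                          AllPairs Disjoint (blockMembers bs)
  blockMembers-disjoint []       []           = []
  blockMembers-disjoint (b ∷ bs) (B∉Bs ∷ Bs!) = apart bs B∉Bs ∷ blockMembers-disjoint bs Bs!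
    where
    apart : ∀ {Bs} (bs : All Block Bs) → All (_ ≢_) Bs → All (Disjoint (members b)) (blockMembers bs)
    apart []         []              = []
    apart (b′ ∷ bs′) (B≢B′ ∷ B∉Bs′) =
      (λ x x∈b x∈b′ → B≢B′ (trans (sym (trace-of b x∈b)) (trace-of b′ x∈b′))) ∷ apart bs′ B∉Bs′

  ∣⋃blockMembers∣ : ∀ {Bs} (bs : All Block Bs) → AllPairs Disjoint (blockMembers bs) →
    ∣ ⋃ (blockMembers bs) ∣ ≡ q * length Bs
  ∣⋃blockMembers∣ []       []              = trans (∣⊥∣≡0 n) (sym (*-zeroʳ q))
  ∣⋃blockMembers∣ {Bs = _ ∷ Bs} (b ∷ bs) (b∉bs ∷ bs!) = begin
    ∣ members b ∪ ⋃ (blockMembers bs) ∣       ≡⟨ ∣∪∣-disjoint (Disjoint-⋃ b∉bs) ⟩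
    ∣ members b ∣ + ∣ ⋃ (blockMembers bs) ∣   ≡⟨ cong₂ _+_ (size b) (∣⋃blockMembers∣ bs bs!) ⟩
    q + q * length Bs                         ≡⟨ *-suc q (length Bs) ⟨
    q * suc (length Bs)                       ∎
    where open ≡-Reasoning

  module _ {u} (u∈U : u ∈ U) where

    ∈N⇒∈trace : ∀ {x} → x ∈ N G u → u ∈ trace G U x
    ∈N⇒∈trace x∈Nu = x∈p∩q⁺ (N-sym G x∈Nu , u∈U)

    ∈trace⇒∈N : ∀ {x} → u ∈ trace G U x → x ∈ N G u
    ∈trace⇒∈N {x} u∈trace = N-sym G (proj₁ (x∈p∩q⁻ (N G x) U u∈trace))

    ∣block∩N∣ : ∀ {B} (b : Block B) → ∣ members b ∩ N G u ∣ ≡ bit (lookup B u) * q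
    ∣block∩N∣ {B} b with lookup B u in Bu
    ... | true  = trans (cong ∣_∣ (⊆-antisym (p∩q⊆p _ _) λ x∈b →
                    x∈p∩q⁺ (x∈b , ∈trace⇒∈N (subst (u ∈_) (sym (trace-of b x∈b)) (lookup⇒[]= u B Bu)))))
                  (trans (size b) (sym (+-identityʳ q)))
    ... | false = trans (cong ∣_∣ (Empty-unique λ (x , x∈b∩Nu) → let x∈b , x∈Nu = x∈p∩q⁻ _ _ x∈b∩Nu in
                    lookup≡false⇒∉ Bu (subst (u ∈_) (trace-of b x∈b) (∈N⇒∈trace x∈Nu))))
                  (∣⊥∣≡0 n)

    ∣⋃blockMembers∩N∣ : ∀ {Bs} (bs : All Block Bs) → AllPairs Disjoint (blockMembers bs) →
      ∣ ⋃ (blockMembers bs) ∩ N G u ∣ ≡ multiplicity Bs u * q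
    ∣⋃blockMembers∩N∣ []       []              = trans (cong ∣_∣ (∩-zeroˡ (N G u))) (∣⊥∣≡0 n)
    ∣⋃blockMembers∩N∣ {Bs = B ∷ Bs} (b ∷ bs) (b∉bs ∷ bs!) = begin
      ∣ (members b ∪ ⋃ (blockMembers bs)) ∩ N G u ∣
        ≡⟨ ∣∪∩∣-disjoint (N G u) (Disjoint-⋃ b∉bs) ⟩
      ∣ members b ∩ N G u ∣ + ∣ ⋃ (blockMembers bs) ∩ N G u ∣
        ≡⟨ cong₂ _+_ (∣block∩N∣ b) (∣⋃blockMembers∩N∣ bs bs!) ⟩
      bit (lookup B u) * q + multiplicity Bs u * q
        ≡⟨ *-distribʳ-+ q (bit (lookup B u)) (multiplicity Bs u) ⟨
      multiplicity (B ∷ Bs) u * q ∎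
      where open ≡-Reasoning

    deg-after-deletion : ∀ {Bs} (bs : All Block Bs) → AllPairs Disjoint (blockMembers bs) →
      deg G A u ≡ deg G (A ─ ⋃ (blockMembers bs)) u + multiplicity Bs u * q
    deg-after-deletion bs bs! =
      trans (∣∩∣-split (λ x∈ → p─q⊆p A U (⋃blockMembers⊆ bs x∈)) (N G u))
            (cong (deg G (A ─ ⋃ (blockMembers bs)) u +_) (∣⋃blockMembers∩N∣ bs bs!))

module ModulusDoubling (G : Graph n) (q : ℕ) .{{_ : NonZero q}} (A U : Subset n)
                      (A-modular : Modular G q A) (U⊆A : U ⊆ A) (u₀ : Fin n) (u₀∈U : u₀ ∈ U) where

  open Deletion G q A U

  residue : ℕ
  residue = deg G A u₀ % q

  quotient : Fin n → ℕ
  quotient u = deg G A u / q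

  deg-decomposition : ∀ {u} → u ∈ U → deg G A u ≡ residue + quotient u * q
  deg-decomposition {u} u∈U = trans (m≡m%n+[m/n]*n (deg G A u) q)
    (cong (_+ quotient u * q) (〔mod〕⇒%≡ (A-modular u u₀ (U⊆A u∈U) (U⊆A u₀∈U))))

  parityShift : Subset n
  parityShift = U ∩ tabulate λ u → odd (quotient u) xor odd (quotient u₀)

  parityShift⊆U : parityShift ⊆ U
  parityShift⊆U = p∩q⊆p U _

  lookup-parityShift : ∀ {u} → u ∈ U → lookup parityShift u ≡ odd (quotient u) xor odd (quotient u₀)
  lookup-parityShift {u} u∈U =
    trans (lookup-zipWith _∧_ u U _) (cong₂ _∧_ ([]=⇒lookup u∈U) (lookup∘tabulate _ u))

  module _ {Bs} (Bs≡shift : sum⊕ Bs ≡ parityShift mod⟨ U ⟩) (bs : All Block Bs)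
           (bs! : AllPairs Disjoint (blockMembers bs)) where

    private
      W : Subset n
      W = A ─ ⋃ (blockMembers bs)

      c : Bool
      c = proj₁ (≡mod⇒pointwise Bs≡shift)

    -- Deleting a block whose trace contains u lowers quotient u by one, so Bs flips exactly the
    -- parities recorded in parityShift.
    parity-after-deletion : ∀ {u} → u ∈ U → odd (quotient u + multiplicity Bs u) ≡ odd (quotient u₀) xor c
    parity-after-deletion {u} u∈U = begin
      odd (quotient u + multiplicity Bs u)  ≡⟨ odd-+ (quotient u) (multiplicity Bs u) ⟩
      p xor odd (multiplicity Bs u)         ≡⟨ cong (p xor_) (odd-multiplicity Bs u) ⟩
      p xor lookup (sum⊕ Bs) u              ≡⟨ cong (p xor_) (proj₂ (≡mod⇒pointwise Bs≡shift) u∈U) ⟩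
      p xor (lookup parityShift u xor c)    ≡⟨ cong (λ s → p xor (s xor c)) (lookup-parityShift u∈U) ⟩
      p xor ((p xor p₀) xor c)              ≡⟨ cong (p xor_) (xor-assoc p p₀ c) ⟩
      p xor (p xor (p₀ xor c))              ≡⟨ xor-cancelˡ p (p₀ xor c) ⟩
      p₀ xor c                              ∎
      where
      open ≡-Reasoning
      p p₀ : Bool
      p  = odd (quotient u)
      p₀ = odd (quotient u₀)

    deg-W-residue : ∀ {u} → u ∈ U →
                    deg G W u ≡ residue + bit (odd (quotient u₀) xor c) * q 〔mod 2 * q 〕
    deg-W-residue {u} u∈U =
      lift-to-2q (multiplicity Bs u) residue (quotient u) q (bit (odd (quotient u₀) xor c))
        (trans (sym (deg-after-deletion u∈U bs bs!)) (deg-decomposition u∈U))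
        (odd≡⇒split (parity-after-deletion u∈U))

    W-congruent : ∀ u v → u ∈ U → v ∈ U → deg G W u ≡ deg G W v 〔mod 2 * q 〕
    W-congruent u v u∈U v∈U = 〔mod〕-trans (deg-W-residue u∈U) (〔mod〕-sym (deg-W-residue v∈U))

    W-modular : (∀ w u → w ∈ W ─ U → u ∈ U → deg G W w ≡ deg G W u 〔mod 2 * q 〕) →
                Modular G (2 * q) W
    W-modular outside≡ x y x∈W y∈W = 〔mod〕-trans (≡u₀ x∈W) (〔mod〕-sym (≡u₀ y∈W))
      where
      ≡u₀ : ∀ {x} → x ∈ W → deg G W x ≡ deg G W u₀ 〔mod 2 * q 〕
      ≡u₀ {x} x∈W with x ∈? U
      ... | yes x∈U = W-congruent x u₀ x∈U u₀∈U
      ... | no  x∉U = outside≡ x u₀ (x∈p∧x∉q⇒x∈p─q x∈W x∉U) u₀∈U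

mainTheorem7 : ∀ {n} (G : Graph n) (k q : ℕ) → q ≡ 2 ^ k →
    (A U : Subset n) → Modular G q A → U ⊆ A → 2 ≤ ∣ U ∣ →
    H₂Connected G q A U →
    ((∃ λ j → ∣ U ∣ ≡ 2 * j) → Σ (Subset n) λ C → C ⊆ U × (∃ λ j → ∣ C ∣ ≡ 1 + 2 * j) × q ≤ count G A U C) →
    -- (1) the classes [1_B] with n_B ≥ q span 𝔽₂^U / ⟨1_U⟩
    (∀ (S : Subset n) → S ⊆ U →
      Σ (List (Subset n)) λ L →
        All (λ B → B ⊆ U × q ≤ count G A U B) L ×
        (sum⊕ L ≡ S ⊎ sum⊕ L ≡ S ⊕ U))
    ×
    -- (2),(3) the deletion set E
    Σ (List (Subset n)) λ Ps →
      ⋃ Ps ⊆ (A ─ U) × ∣ ⋃ Ps ∣ ≤ q * (∣ U ∣ ∸ 1) ×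
      All (λ P → ∣ P ∣ ≡ q × (Σ (Subset n) λ B → ∀ x → x ∈ P → trace G U x ≡ B)) Ps ×
      AllPairs Disjoint Ps ×
      (∀ u v → u ∈ U → v ∈ U → deg G (A ─ ⋃ Ps) u ≡ deg G (A ─ ⋃ Ps) v 〔mod 2 * q 〕) ×
      ((∀ w u → w ∈ ((A ─ ⋃ Ps) ─ U) → u ∈ U → deg G (A ─ ⋃ Ps) w ≡ deg G (A ─ ⋃ Ps) u 〔mod 2 * q 〕) →
        Modular G (2 * q) (A ─ ⋃ Ps))
mainTheorem7 G k q q≡2^k A U A-modular U⊆A 2≤∣U∣ connected oddGood =
  let u₀ , u₀∈U = nonempty (≤-trans (s≤s z≤n) 2≤∣U∣)
      open Spanning G q A U
      open Deletion G q A U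
      open ModulusDoubling G q {{subst NonZero (sym q≡2^k) (m^n≢0 2 k)}} A U A-modular U⊆A u₀ u₀∈U
      L , goodL , L≡shift = spans-quotient connected oddGood parityShift⊆U
      Bs , goodBs , Bs! , length≤ , Bs≡shift = shorten-mod u₀ proj₁ goodL L≡shift
      bs = All.map (block ∘ proj₂) goodBs
      bs! = blockMembers-disjoint bs Bs!
  in (λ S S⊆U → spans-quotient connected oddGood S⊆U) ,
     blockMembers bs , ⋃blockMembers⊆ bs ,
     ≤-trans (≤-reflexive (∣⋃blockMembers∣ bs bs!))
             (*-monoʳ-≤ q (≤-trans length≤ (∣p-x∣≤∣p∣∸1 u₀∈U))) ,
     blockMembers-shape bs , bs! , W-congruent Bs≡shift bs bs! , W-modular Bs≡shift bs bs!
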